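{- Let $M$ be a monotonic machine over a finite alphabet $\Sigma$ and let $v$ be a state of $M$. Then a sequence $s$ covers $v$ in $M$ if and only if $s$ covers the state $\{v\}$ in the transformed machine $S(M)$.
   Context: A machine $M$ is a finite DAG whose edges $e$ carry labels $\mathrm{lab}(e) \in \Sigma$, with a designated initial state $i$ having no incoming edges. An edge $(w,v)$ makes $w$ a parent state of $v$; ancestors are obtained by iterating this relation. A sequence $s = s_1 \cdots s_L$ covers a state $v$ if there exist indices $i_1 < \dots < i_N$ and a directed path from the initial state to $v$ consisting of $N$ edges labeled, in order, $s_{i_1}, \dots, s_{i_N}$. The initial state is covered by every sequence. $M$ is monotonic if every sequence covering a state also covers all its parent states. Construction of $S(M)$. For a set $V$ of states and $a \in \Sigma$: - $\mathrm{sub}(V;a) = \{w : (w,v) \text{ is an edge labeled } a,\ v \in V\}$; - $\mathrm{par}(V;a) = \min(\mathrm{sub}(V;a) \cup V)$, where $\min(X)$ keeps the states of $X$ having no proper ancestor in $X$; - $\mathrm{inc}(V)$ is the set of labels of edges entering states of $V$; - $\mathrm{cl}(V) = \{V\} \cup \bigcup_{a \in \mathrm{inc}(V)} \mathrm{cl}(\mathrm{par}(V;a))$, with $\mathrm{cl}(V) = \{V\}$ if $\mathrm{inc}(V) = \emptyset$. The states of $S(M)$ are the members of $\bigcup_{v \in V(M)} \mathrm{cl}(\{v\})$; in particular, $\{v\}$ is a state for every $v$. For each state $V$ and each $a \in \mathrm{inc}(V)$, $S(M)$ has an edge labeled $a$ from $\mathrm{par}(V;a)$ to $V$. The initial state of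 $S(M)$ is $\{i\}$. -}

module Defs where

open import Data.Nat using (ℕ)
open import Data.Fin using (Fin)
open import Data.Fin.Subset using (Subset; _∈_; _∉_)
open import Data.List using (List; []; _∷_)
open import Data.List.Membership.Propositional using () renaming (_∈_ to _∈ₗ_)
open import Data.List.Relation.Binary.Sublist.Propositional using (_⊆_)
open import Data.Product using (Σ; ∃; _×_; _,_)
open import Relation.Binary.Construct.Closure.Transitive using (TransClosure)
open import Relation.Nullary using (¬_)
open import Function.Bundles using (_⇔_)

data Path {Q L : Set} (E : Q → L → Q → Set) : Q → List L → Q → Set where
  nil  : ∀ {q} → Path E q [] q
  cons : ∀ {q q' r a w} → E q a q' → Path E q' w r → Path E q (a ∷ w) r

Covers : {Q L : Set} (E : Q → L → Q → Set) (q₀ : Q) → List L → Q → Set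
Covers {L = L} E q₀ s v = Σ (List L) λ w → Path E q₀ w v × w ⊆ s

Edge : ∀ {n k} → List (Fin n × Fin k × Fin n) → Fin n → Fin k → Fin n → Set
Edge es w a v = (w , a , v) ∈ₗ es

Parent : ∀ {n k} → List (Fin n × Fin k × Fin n) → Fin n → Fin n → Set
Parent {k = k} es w v = Σ (Fin k) λ a → Edge es w a v

Ancestor : ∀ {n k} → List (Fin n × Fin k × Fin n) → Fin n → Fin n → Set
Ancestor es = TransClosure (Parent es)

record Machine (k : ℕ) : Set where
  field
    n        : ℕ
    edges    : List (Fin n × Fin k × Fin n)
    init     : Fin n
    acyclic  : ∀ v → ¬ Ancestor edges v v
    init-src : ∀ w a → ¬ Edge edges w a init

module _ {k : ℕ} (M : Machine k) where
  open Machine M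

  CoversM : List (Fin k) → Fin n → Set
  CoversM = Covers (Edge edges) init

  Monotonic : Set
  Monotonic = ∀ s v w → CoversM s v → Parent edges w v → CoversM s w

  InSub : Subset n → Fin k → Fin n → Set
  InSub V a w = ∃ λ v → v ∈ V × Edge edges w a v

  InX : Subset n → Fin k → Fin n → Set
  InX V a w = InSub V a w Data.Sum.⊎ w ∈ V
    where import Data.Sum

  IsPar : Subset n → Fin k → Subset n → Set
  IsPar V a P = ∀ w → (w ∈ P) ⇔ (InX V a w × ¬ (∃ λ u → InX V a u × Ancestor edges u w))

  Inc : Subset n → Fin k → Set
  Inc V a = ∃ λ w → ∃ λ v → v ∈ V × Edge edges w a v

  -- states of S(M): ⋃_v cl({v}), i.e. the least family containing all
  -- singletons and closed under V ↦ par(V;a) for a ∈ inc(V)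
  data StateS : Subset n → Set where
    sing : ∀ v → StateS (Data.Fin.Subset.⁅ v ⁆)
    step : ∀ {V a P} → StateS V → Inc V a → IsPar V a P → StateS P

  EdgeS : Subset n → Fin k → Subset n → Set
  EdgeS P a V = StateS V × Inc V a × IsPar V a P

  CoversS : List (Fin k) → Subset n → Set
  CoversS = Covers EdgeS (Data.Fin.Subset.⁅ init ⁆)

module Submission where

-- Every edge par(V;a) → V of S(M) can be followed in M from any state of par(V;a), either
-- along an a-edge into V or by staying put, so covering ⁅ v ⁆ in S(M) covers v in M.
-- Conversely, a path of M covering v is turned into a path of S(M) from its last letter
-- backwards: the current S(M)-state is an antichain of covered states, a minimal element of
-- sub(V;a) ∪ V below the source of the last edge is still covered by the shorter prefix
-- because M is monotonic, and at the empty prefix the antichain must be ⁅ init ⁆.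

open import Defs
open import Data.Nat using (ℕ)
open import Data.Fin using (Fin; zero; suc)
open import Data.Fin.Properties using (any?; _≟_)
open import Data.Fin.Induction using (spo-wellFounded; spo-noetherian)
open import Data.Fin.Subset using (Subset; _∈_; ⁅_⁆)
open import Data.Fin.Subset.Properties using (_∈?_; x∈⁅x⁆; x∈⁅y⁆⇒x≡y; ⊆-antisym)
open import Data.Vec.Base using ([]; _∷_; here; there)
open import Data.List using (List; []; _∷_; _++_; [_])
open import Data.List.Properties using (++-assoc; ++-identityʳ)
open import Data.List.Reverse using (Reverse; []; _∶_∶ʳ_; reverseView)
import Data.List.Membership.DecPropositional as DecMembership
open import Data.List.Relation.Binary.Sublist.Heterogeneous using ([]; _∷_; _∷ʳ_)
open import Data.List.Relation.Binary.Sublist.Propositional using (_⊆_; ⊆-refl; ⊆-trans)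
open import Data.List.Relation.Binary.Sublist.Propositional.Properties using (++⁺; ++⁺ʳ)
open import Data.Product using (∃; _×_; _,_; proj₁; proj₂; map₁; map₂)
open import Data.Product.Properties using (≡-dec)
open import Data.Sum using (_⊎_; inj₁; inj₂)
import Data.Sum as Sum
open import Function using (_∘_; flip)
open import Function.Bundles using (_⇔_; mk⇔; Equivalence)
open import Level using (0ℓ)
open import Induction.WellFounded using (Acc; acc)
open import Relation.Binary using (Rel; Decidable; IsStrictPartialOrder)
open import Relation.Binary.PropositionalEquality using (_≡_; refl; sym; subst; subst₂; resp₂; isEquivalence)
open import Relation.Binary.Construct.Closure.Transitive using (TransClosure; _∷_) renaming (_++_ to _⁺++_)
import Relation.Binary.Construct.Closure.Transitive as TC
open import Relation.Nullary using (¬_; Dec; yes; no; does; contradiction)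
open import Relation.Nullary.Decidable using (_×-dec_; _⊎-dec_; ¬?; map′)

subset : ∀ {m} {P : Fin m → Set} → (∀ x → Dec (P x)) → Subset m
subset {ℕ.zero}  P? = []
subset {ℕ.suc m} P? = does (P? zero) ∷ subset (P? ∘ suc)

∈-subset : ∀ {m} {P : Fin m → Set} (P? : ∀ x → Dec (P x)) x → x ∈ subset P? ⇔ P x
∈-subset P? x = mk⇔ (to P? x) (from P? x)
  where
  to : ∀ {m} {P : Fin m → Set} (P? : ∀ x → Dec (P x)) x → x ∈ subset P? → P x
  to P? zero x∈ with P? zero | x∈
  ... | yes px | _ = px
  ... | no _   | ()
  to P? (suc x) (there x∈) = to (P? ∘ suc) x x∈

  from : ∀ {m} {P : Fin m → Set} (P? : ∀ x → Dec (P x)) x → P x → x ∈ subset P?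
  from P? zero px with P? zero
  ... | yes _ = here
  ... | no ¬px = contradiction px ¬px
  from P? (suc x) px = there (from (P? ∘ suc) x px)

module FiniteDAG {n : ℕ} {_↝_ : Rel (Fin n) 0ℓ} (_↝?_ : Decidable _↝_)
                 (acyclic : ∀ x → ¬ TransClosure _↝_ x x) where

  _↝⁺_ : Rel (Fin n) 0ℓ
  _↝⁺_ = TransClosure _↝_

  ↝⁺-isStrictPartialOrder : IsStrictPartialOrder _≡_ _↝⁺_
  ↝⁺-isStrictPartialOrder = record
    { isEquivalence = isEquivalence
    ; irrefl        = λ { refl → acyclic _ }
    ; trans         = _⁺++_
    ; <-resp-≈      = resp₂ _↝⁺_
    }

  ↝⁺-unfold : ∀ {x z} → x ↝⁺ z ⇔ ∃ λ y → x ↝ y × (y ≡ z ⊎ y ↝⁺ z)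
  ↝⁺-unfold = mk⇔ to from
    where
    to : ∀ {x z} → x ↝⁺ z → ∃ λ y → x ↝ y × (y ≡ z ⊎ y ↝⁺ z)
    to TC.[ r ] = _ , r , inj₁ refl
    to (r ∷ t)  = _ , r , inj₂ t

    from : ∀ {x z} → (∃ λ y → x ↝ y × (y ≡ z ⊎ y ↝⁺ z)) → x ↝⁺ z
    from (_ , r , inj₁ refl) = TC.[ r ]
    from (_ , r , inj₂ t)    = r ∷ t

  _↝⁺?_ : Decidable _↝⁺_
  x ↝⁺? z = decide (spo-noetherian ↝⁺-isStrictPartialOrder x)
    where
    decide : ∀ {x} → Acc (flip _↝⁺_) x → Dec (x ↝⁺ z)
    decide {x} (acc rec) =
      map′ (Equivalence.from ↝⁺-unfold) (Equivalence.to ↝⁺-unfold) (any? via)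
      where
      via : ∀ y → Dec (x ↝ y × (y ≡ z ⊎ y ↝⁺ z))
      via y with x ↝? y
      ... | yes r = map′ (r ,_) proj₂ ((y ≟ z) ⊎-dec decide (rec TC.[ r ]))
      ... | no ¬r = no (¬r ∘ proj₁)

  Minimal : (Fin n → Set) → Fin n → Set
  Minimal X m = X m × ¬ (∃ λ u → X u × u ↝⁺ m)

  minimal-below : ∀ {X : Fin n → Set} → (∀ x → Dec (X x)) →
                  ∀ {z} → X z → ∃ λ m → Minimal X m × (m ≡ z ⊎ m ↝⁺ z)
  minimal-below {X} X? {z} = descend (spo-wellFounded ↝⁺-isStrictPartialOrder z)
    where
    descend : ∀ {z} → Acc _↝⁺_ z → X z → ∃ λ m → Minimal X m × (m ≡ z ⊎ m ↝⁺ z)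
    descend {z} (acc rec) Xz with any? (λ u → X? u ×-dec u ↝⁺? z)
    ... | no none = z , (Xz , none) , inj₁ refl
    ... | yes (u , Xu , u↝⁺z) with descend (rec u↝⁺z) Xu
    ...   | m , minimal , inj₁ refl = m , minimal , inj₂ u↝⁺z
    ...   | m , minimal , inj₂ m↝⁺u = m , minimal , inj₂ (m↝⁺u ⁺++ u↝⁺z)

module _ {Q L : Set} {E : Q → L → Q → Set} where

  path⇒≡⊎⁺ : ∀ {q w r} → Path E q w r → q ≡ r ⊎ TransClosure (λ x y → ∃ λ a → E x a y) q r
  path⇒≡⊎⁺ nil = inj₁ refl
  path⇒≡⊎⁺ (cons e p) with path⇒≡⊎⁺ p
  ... | inj₁ refl = inj₂ TC.[ _ , e ]
  ... | inj₂ t    = inj₂ ((_ , e) ∷ t)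

  path-++⁺ : ∀ {q r r' w a} → Path E q w r → E r a r' → Path E q (w ++ [ a ]) r'
  path-++⁺ nil        e = cons e nil
  path-++⁺ (cons e p) f = cons e (path-++⁺ p f)

  covers-[] : ∀ {q} → Covers E q [] q
  covers-[] = [] , nil , []

  covers-[]⁻ : ∀ {q r} → Covers E q [] r → r ≡ q
  covers-[]⁻ (.[] , nil , []) = refl

  covers-⊆ : ∀ {q r s t} → s ⊆ t → Covers E q s r → Covers E q t r
  covers-⊆ s⊆t (w , p , w⊆s) = w , p , ⊆-trans w⊆s s⊆t

  covers-∷⁺ : ∀ {q q' r a s} → E q a q' → Covers E q' s r → Covers E q (a ∷ s) r
  covers-∷⁺ e (w , p , w⊆s) = _ ∷ w , cons e p , refl ∷ w⊆s

  covers-++⁺ : ∀ {q r r' a s} → Covers E q s r → E r a r' → Covers E q (s ++ [ a ]) r'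
  covers-++⁺ (w , p , w⊆s) e = w ++ [ _ ] , path-++⁺ p e , ++⁺ w⊆s ⊆-refl

  covers-++⁻ : ∀ {q r a} s → Covers E q (s ++ [ a ]) r →
               Covers E q s r ⊎ ∃ λ r' → Covers E q s r' × E r' a r
  covers-++⁻ []      (.[] , nil , _ ∷ʳ [])           = inj₁ covers-[]
  covers-++⁻ []      (_ , cons e nil , refl ∷ [])    = inj₂ (_ , covers-[] , e)
  covers-++⁻ (x ∷ s) (w , p , _ ∷ʳ w⊆s)              =
    Sum.map (covers-⊆ (x ∷ʳ ⊆-refl)) (map₂ (map₁ (covers-⊆ (x ∷ʳ ⊆-refl))))
            (covers-++⁻ s (w , p , w⊆s))
  covers-++⁻ (x ∷ s) (_ , cons e p , refl ∷ w⊆s)     =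
    Sum.map (covers-∷⁺ e) (map₂ (map₁ (covers-∷⁺ e))) (covers-++⁻ s (_ , p , w⊆s))

module _ {k : ℕ} (M : Machine k) where
  open Machine M

  open DecMembership (≡-dec (_≟_ {n}) (≡-dec (_≟_ {k}) (_≟_ {n})))
    using () renaming (_∈?_ to _∈ₗ?_)

  edge? : ∀ w a v → Dec (Edge edges w a v)
  edge? w a v = (w , a , v) ∈ₗ? edges

  parent? : Decidable (Parent edges)
  parent? w v = any? (λ a → edge? w a v)

  open FiniteDAG parent? acyclic using (_↝⁺?_; Minimal; minimal-below)

  InX? : ∀ V a w → Dec (InX M V a w)
  InX? V a w = any? (λ v → (v ∈? V) ×-dec edge? w a v) ⊎-dec (w ∈? V)

  par : Subset n → Fin k → Subset n
  par V a = subset (λ w → InX? V a w ×-dec ¬? (any? λ u → InX? V a u ×-dec u ↝⁺? w))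

  par-isPar : ∀ V a → IsPar M V a (par V a)
  par-isPar V a = ∈-subset _

  edgeS-simulate : ∀ {P a V q s} → EdgeS M P a V → q ∈ P → CoversM M s q →
                   ∃ λ u → u ∈ V × CoversM M (s ++ [ a ]) u
  edgeS-simulate (_ , _ , isPar) q∈P cov with proj₁ (Equivalence.to (isPar _) q∈P)
  ... | inj₁ (v , v∈V , e) = v , v∈V , covers-++⁺ cov e
  ... | inj₂ q∈V           = _ , q∈V , covers-⊆ (++⁺ʳ _ ⊆-refl) cov

  pathS-simulate : ∀ {P w V q s} → Path (EdgeS M) P w V → q ∈ P → CoversM M s q →
                   ∃ λ u → u ∈ V × CoversM M (s ++ w) u
  pathS-simulate {s = s} nil q∈P cov =
    _ , q∈P , subst (λ t → CoversM M t _) (sym (++-identityʳ s)) cov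
  pathS-simulate {s = s} (cons {a = a} {w = w} e p) q∈P cov with edgeS-simulate e q∈P cov
  ... | _ , q'∈ , cov' =
    subst (λ t → ∃ λ u → u ∈ _ × CoversM M t u) (++-assoc s [ a ] w) (pathS-simulate p q'∈ cov')

  -- The invariant of the states of S(M) met while building a covering path backwards from ⁅ v ⁆.
  record Admissible (V : Subset n) : Set where
    field
      state     : StateS M V
      antichain : ∀ {x y} → x ∈ V → y ∈ V → ¬ Ancestor edges x y
      covered   : ∀ {x} → x ∈ V → ∃ λ s → CoversM M s x

  singleton-admissible : ∀ {s v} → CoversM M s v → Admissible ⁅ v ⁆
  singleton-admissible {s} {v} cov = record
    { state     = sing v
    ; antichain = λ x∈ y∈ → subst₂ (λ x y → ¬ Ancestor edges x y)
                                   (sym (x∈⁅y⁆⇒x≡y v x∈)) (sym (x∈⁅y⁆⇒x≡y v y∈)) (acyclic v)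
    ; covered   = λ x∈ → s , subst (CoversM M s) (sym (x∈⁅y⁆⇒x≡y v x∈)) cov
    }

  admissible-init : ∀ {V} → Admissible V → init ∈ V → V ≡ ⁅ init ⁆
  admissible-init {V} adm init∈V = ⊆-antisym V⊆ ⊆V
    where
    open Admissible adm
    V⊆ : ∀ {x} → x ∈ V → x ∈ ⁅ init ⁆
    V⊆ x∈V with covered x∈V
    ... | _ , _ , p , _ with path⇒≡⊎⁺ p
    ...   | inj₁ refl      = x∈⁅x⁆ init
    ...   | inj₂ init↝⁺x   = contradiction init↝⁺x (antichain init∈V x∈V)
    ⊆V : ∀ {x} → x ∈ ⁅ init ⁆ → x ∈ V
    ⊆V x∈ = subst (_∈ V) (sym (x∈⁅y⁆⇒x≡y init x∈)) init∈V

  module _ (mono : Monotonic M) where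

    covers-ancestor : ∀ {s v w} → CoversM M s v → Ancestor edges w v → CoversM M s w
    covers-ancestor cov TC.[ p ] = mono _ _ _ cov p
    covers-ancestor cov (p ∷ a)  = mono _ _ _ (covers-ancestor cov a) p

    par-admissible : ∀ {V a} → Admissible V → Inc M V a → Admissible (par V a)
    par-admissible {V} {a} adm inc = record
      { state     = step state inc (par-isPar V a)
      ; antichain = λ x∈ y∈ x↝⁺y → proj₂ (member y∈) (_ , proj₁ (member x∈) , x↝⁺y)
      ; covered   = λ x∈ → covered-InX (proj₁ (member x∈))
      }
      where
      open Admissible adm
      member : ∀ {x} → x ∈ par V a → Minimal (InX M V a) x
      member = Equivalence.to (par-isPar V a _)
      covered-InX : ∀ {x} → InX M V a x → ∃ λ s → CoversM M s x
      covered-InX (inj₁ (v , v∈V , e)) = map₂ (λ cov → mono _ _ _ cov (a , e)) (covered v∈V)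
      covered-InX (inj₂ x∈V)           = covered x∈V

    covers⇒coversS : ∀ {s V u} → Reverse s → Admissible V → u ∈ V → CoversM M s u →
                     CoversS M s V
    covers⇒coversS {V = V} [] adm u∈V cov
      with admissible-init adm (subst (_∈ V) (covers-[]⁻ cov) u∈V)
    ... | refl = covers-[]
    covers⇒coversS {V = V} {u} (s ∶ rs ∶ʳ a) adm u∈V cov with covers-++⁻ s cov
    ... | inj₁ cov-s = covers-⊆ (++⁺ʳ _ ⊆-refl) (covers⇒coversS rs adm u∈V cov-s)
    ... | inj₂ (z , cov-z , e) with minimal-below (InX? V a) (inj₁ (u , u∈V , e))
    ...   | m , minimal , m≡z⊎m↝⁺z =
      covers-++⁺ (covers⇒coversS rs (par-admissible adm inc) m∈par cov-m)
                 (Admissible.state adm , inc , par-isPar V a)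
      where
      inc : Inc M V a
      inc = z , u , u∈V , e
      m∈par : m ∈ par V a
      m∈par = Equivalence.from (par-isPar V a m) minimal
      cov-m : CoversM M s m
      cov-m = Sum.[ (λ { refl → cov-z }) , covers-ancestor cov-z ] m≡z⊎m↝⁺z

mainTheorem5 : ∀ {k : ℕ} (M : Machine k) → Monotonic M →
    (v : Fin (Machine.n M)) (s : List (Fin k)) →
    CoversM M s v ⇔ CoversS M s ⁅ v ⁆
mainTheorem5 M mono v s = mk⇔ to from
  where
  to : CoversM M s v → CoversS M s ⁅ v ⁆
  to cov = covers⇒coversS M mono (reverseView s) (singleton-admissible M cov) (x∈⁅x⁆ v) cov

  from : CoversS M s ⁅ v ⁆ → CoversM M s v
  from (w , p , w⊆s) with pathS-simulate M p (x∈⁅x⁆ (Machine.init M)) covers-[]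
  ... | u , u∈⁅v⁆ , cov = subst (CoversM M s) (x∈⁅y⁆⇒x≡y v u∈⁅v⁆) (covers-⊆ w⊆s cov)
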